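{- Let $\mathbf{p}=p_{n-1}\dots p_0$ be an $(m,n)$-parking function and $\Delta$ a bounded, co-bounded $m$-invariant set with $\mathbf{p}\cdot\Delta=\Delta+n$. For $0\le i\le n-1$ put $\Delta^{(i)}=p_{i-1}\cdots p_0\cdot\Delta$ and let $a$ be the $p_i$-th smallest (indexing from $0$) $m$-generator of $\Delta^{(i)}$, i.e. the element removed by the letter $p_i$. Then $a$ is an $n$-generator of $\Delta^{(i)}$.
   Context: $[m]=\{0,\dots,m-1\}$. $\Delta\subset\mathbb{Z}$ is $k$-invariant if $\Delta+k\subset\Delta$; bounded = has a minimum, co-bounded = contains $\mathbb{Z}_{\ge K}$ for some $K$. An element $a\in\Delta$ is a $k$-generator if $a-k\notin\Delta$. For an $m$-invariant $\Delta$ with $m$-generators $a_0<\dots<a_{m-1}$, a letter $j\in[m]$ acts by $j\cdot\Delta=\Delta\setminus\{a_j\}$; words act from right to left (letter $p_0$ first). An $(m,n)$-parking function is $\mathbf{p}=p_{n-1}\dots p_0\in[m]^n$ with $\#\{j:p_j<i\}\ge in/m$ for $1\le i\le m$. -}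

module Defs where

open import Data.Nat as ℕ using (ℕ; suc)
open import Data.Integer as ℤ using (ℤ; +_; _+_; _-_; _≤_; _<_)
open import Data.Fin using (Fin; toℕ; inject₁; fromℕ) renaming (zero to fzero; suc to fsuc)
open import Data.List using (List; length; filter; allFin)
open import Data.List.Membership.Propositional using (_∈_)
open import Data.List.Relation.Unary.All using (All)
open import Data.List.Relation.Unary.Unique.Propositional using (Unique)
open import Data.Product using (Σ; ∃; _×_)
open import Relation.Nullary using (¬_)
open import Relation.Binary.PropositionalEquality using (_≡_; _≢_)

SubZ : Set₁
SubZ = ℤ → Set

_≐_ : SubZ → SubZ → Set
A ≐ B = ∀ x → (A x → B x) × (B x → A x)

Invariant : ℕ → SubZ → Set
Invariant k Δ = ∀ x → Δ x → Δ (x + + k)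

Bounded : SubZ → Set
Bounded Δ = ∃ λ b → ∀ x → Δ x → b ≤ x

CoBounded : SubZ → Set
CoBounded Δ = ∃ λ K → ∀ x → K ≤ x → Δ x

IsGen : ℕ → SubZ → ℤ → Set
IsGen k Δ a = Δ a × ¬ Δ (a - + k)

-- a is the j-th smallest (from 0) m-generator of Δ: a is an m-generator and
-- there are exactly j m-generators of Δ below a (listed without repetition).
NthGen : ℕ → SubZ → ℕ → ℤ → Set
NthGen m Δ j a =
  IsGen m Δ a ×
  Σ (List ℤ) λ ls →
    length ls ≡ j × Unique ls ×
    All (λ b → IsGen m Δ b × b < a) ls ×
    (∀ b → IsGen m Δ b → b < a → b ∈ ls)

-- Δ' = j · Δ = Δ ∖ {a_j} (relationally, up to extensional equality).
Step : ℕ → ℕ → SubZ → SubZ → Set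
Step m j Δ Δ' = ∃ λ a → NthGen m Δ j a × (Δ' ≐ (λ x → Δ x × x ≢ a))

shift : SubZ → ℕ → SubZ
shift Δ n x = Δ (x - + n)

countBelow : ∀ {n m} → (Fin n → Fin m) → ℕ → ℕ
countBelow {n} p i = length (filter (λ j → toℕ (p j) ℕ.<? i) (allFin n))

-- p = p_{n-1} … p_0 (p j = p_j) is an (m,n)-parking function:
-- #{j : p_j < i} ≥ i n / m for 1 ≤ i ≤ m  (cleared of denominators).
IsParking : (m n : ℕ) → (Fin n → Fin m) → Set
IsParking m n p = ∀ i → 1 ℕ.≤ i → i ℕ.≤ m → i ℕ.* n ℕ.≤ m ℕ.* countBelow p i

{-# OPTIONS --safe #-}
-- The letters only delete elements, so Δ^{(i)} ⊆ Δ and Δ + n = p·Δ ⊆ Δ^{(i+1)} = Δ^{(i)} ∖ {a}.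
-- Hence a − n ∈ Δ^{(i)} would give a − n ∈ Δ, i.e. a ∈ Δ + n, contradicting a ∉ Δ^{(i+1)}.
-- As Step only says that Δ^{(i+1)} is Δ^{(i)} minus some p_i-th generator, this uses that the
-- p_i-th generator is unique, by a pigeonhole count of the smaller generators.
module Submission where

open import Defs
open import Data.Nat using (ℕ; suc; _≤_; z≤n; s≤s)
open import Data.Nat.Properties using (<-irrefl)
open import Data.Integer using (ℤ; _-_; +_; _<_)
open import Data.Integer.Properties using (≤-antisym; ≮⇒≥; <-trans; <⇒≢)
open import Data.Fin using (Fin; toℕ; inject₁; fromℕ; zero; suc)
import Data.Fin as Fin
open import Data.Fin.Properties using (≤fromℕ)
open import Data.List using (List; []; _∷_; length)
open import Data.List.Properties using (length-removeAt′)
open import Data.List.Membership.Propositional using (_∈_; _─_)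
open import Data.List.Relation.Unary.Any using (here; there)
import Data.List.Relation.Unary.All as All
open import Data.List.Relation.Unary.AllPairs using ([]; _∷_)
open import Data.List.Relation.Unary.Unique.Propositional using (Unique)
open import Data.List.Relation.Binary.Subset.Propositional using () renaming (_⊆_ to _⊆ˡ_)
open import Data.Product using (_,_; proj₁; proj₂)
open import Data.Empty using (⊥-elim)
open import Function using (_∘_; id)
open import Relation.Nullary using (¬_)
open import Relation.Unary using (_⊆_)
open import Relation.Binary.PropositionalEquality using (_≡_; _≢_; refl; sym; subst)

∈-─⁺ : ∀ {A : Set} {x y : A} {xs : List A} (x∈xs : x ∈ xs) → y ∈ xs → y ≢ x → y ∈ xs ─ x∈xs
∈-─⁺ (here refl)   (here refl)  y≢x = ⊥-elim (y≢x refl)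
∈-─⁺ (here _)      (there y∈xs) _   = y∈xs
∈-─⁺ (there _)     (here refl)  _   = here refl
∈-─⁺ (there x∈xs)  (there y∈xs) y≢x = there (∈-─⁺ x∈xs y∈xs y≢x)

Unique-⊆⇒length-≤ : ∀ {A : Set} {xs ys : List A} → Unique xs → xs ⊆ˡ ys → length xs ≤ length ys
Unique-⊆⇒length-≤ {xs = []} [] _ = z≤n
Unique-⊆⇒length-≤ {xs = x ∷ xs} {ys} (x∉xs ∷ xs!) xs⊆ys =
  subst (length (x ∷ xs) ≤_) (sym (length-removeAt′ ys _))
    (s≤s (Unique-⊆⇒length-≤ xs! λ z∈xs →
      ∈-─⁺ x∈ys (xs⊆ys (there z∈xs)) (λ z≡x → All.lookup x∉xs z∈xs (sym z≡x))))
  where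
  x∈ys : x ∈ ys
  x∈ys = xs⊆ys (here refl)

module _ {m : ℕ} {Δ : SubZ} {j : ℕ} where

  NthGen-≮ : ∀ {a b} → NthGen m Δ j a → NthGen m Δ j b → ¬ a < b
  NthGen-≮ {a} (a-gen , ls , ∣ls∣≡j , ls! , ls<a , _)
              (_ , ls′ , ∣ls′∣≡j , _ , _ , ls′-complete) a<b =
    <-irrefl (sym ∣ls′∣≡j) (subst (λ k → suc k ≤ length ls′) ∣ls∣≡j
      (Unique-⊆⇒length-≤ a∷ls! a∷ls⊆ls′))
    where
    a∷ls! : Unique (a ∷ ls)
    a∷ls! = All.map (λ c<a a≡c → <⇒≢ (proj₂ c<a) (sym a≡c)) ls<a ∷ ls!

    a∷ls⊆ls′ : (a ∷ ls) ⊆ˡ ls′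
    a∷ls⊆ls′ (here refl) = ls′-complete a a-gen a<b
    a∷ls⊆ls′ (there c∈ls) with c-gen , c<a ← All.lookup ls<a c∈ls =
      ls′-complete _ c-gen (<-trans c<a a<b)

  NthGen-unique : ∀ {a b} → NthGen m Δ j a → NthGen m Δ j b → a ≡ b
  NthGen-unique a-gen b-gen = ≤-antisym (≮⇒≥ (NthGen-≮ b-gen a-gen)) (≮⇒≥ (NthGen-≮ a-gen b-gen))

  Step-⊆ : ∀ {Δ′} → Step m j Δ Δ′ → Δ′ ⊆ Δ
  Step-⊆ (_ , _ , Δ′≐Δ∖a) = proj₁ ∘ proj₁ (Δ′≐Δ∖a _)

  Step-removes : ∀ {Δ′ a} → Step m j Δ Δ′ → NthGen m Δ j a → ¬ Δ′ a
  Step-removes (b , b-gen , Δ′≐Δ∖b) a-gen a∈Δ′ =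
    proj₂ (proj₁ (Δ′≐Δ∖b _) a∈Δ′) (NthGen-unique a-gen b-gen)

Descending : ∀ {n} → (Fin (suc n) → SubZ) → Set
Descending D = ∀ i → D (suc i) ⊆ D (inject₁ i)

Descending-antitone : ∀ {n} {D : Fin (suc n) → SubZ} → Descending D →
  ∀ {i j : Fin (suc n)} → i Fin.≤ j → D j ⊆ D i
Descending-antitone {_}     _      {zero}  {zero}  _         = id
Descending-antitone {suc _} {D} D↓ {zero}  {suc j} _         =
  D↓ zero ∘ Descending-antitone {D = D ∘ suc} (D↓ ∘ suc) {zero} {j} z≤n
Descending-antitone {suc _} {D} D↓ {suc i} {suc j} (s≤s i≤j) =
  Descending-antitone {D = D ∘ suc} (D↓ ∘ suc) i≤j

mainTheorem6 : (m n : ℕ) (p : Fin n → Fin m) → IsParking m n p →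
    (Δ : SubZ) → Bounded Δ → CoBounded Δ → Invariant m Δ →
    -- D i = Δ^{(i)} = p_{i-1} ⋯ p_0 · Δ, for 0 ≤ i ≤ n
    (D : Fin (ℕ.suc n) → SubZ) → D zero ≐ Δ →
    (∀ (i : Fin n) → Step m (toℕ (p i)) (D (inject₁ i)) (D (suc i))) →
    -- hypothesis p · Δ = Δ + n
    D (fromℕ n) ≐ shift Δ n →
    ∀ (i : Fin n) (a : ℤ) → NthGen m (D (inject₁ i)) (toℕ (p i)) a →
    IsGen n (D (inject₁ i)) a
mainTheorem6 m n p _ Δ _ _ _ D D₀≐Δ step Dₙ≐Δ+n i a a-gen = proj₁ (proj₁ a-gen) , a-n∉Dᵢ
  where
  D↓ : Descending D
  D↓ k = Step-⊆ (step k)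

  a-n∉Dᵢ : ¬ D (inject₁ i) (a - + n)
  a-n∉Dᵢ a-n∈Dᵢ = Step-removes (step i) a-gen a∈Dᵢ₊₁
    where
    a-n∈Δ : Δ (a - + n)
    a-n∈Δ = proj₁ (D₀≐Δ _) (Descending-antitone {D = D} D↓ z≤n a-n∈Dᵢ)

    a∈Dᵢ₊₁ : D (suc i) a
    a∈Dᵢ₊₁ = Descending-antitone {D = D} D↓ (≤fromℕ (suc i)) (proj₂ (Dₙ≐Δ+n a) a-n∈Δ)
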